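{- Let $G$ be a connected closed claw-free non-traceable graph on $n$ vertices. If $\omega(G)\geq n-3$, then $G\cong EN_n$.
   Context: All graphs are finite and simple; claw-free means no induced $K_{1,3}$; traceable means having a Hamilton path; $\omega(G)$ is the clique number. In a claw-free graph $G$, a vertex $x$ is eligible if $N(x)$ induces a connected but not complete subgraph; the local completion at $x$ adds all missing edges inside $N(x)$; the closure $cl(G)$ is obtained by repeatedly completing at eligible vertices until none remains; $G$ is closed if $cl(G)=G$, i.e., $G$ has no eligible vertex. For $n\geq 6$, $EN_n$ is the graph obtained from $K_{n-3}$ by choosing three distinct vertices of it and attaching to each a new pendant vertex. -}

module Defs where

open import Data.Nat using (ℕ; _≤_; _<_; _∸_; _<ᵇ_; _≡ᵇ_)
open import Data.Fin using (Fin; toℕ)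
open import Data.Bool using (Bool; true; false; _∧_; _∨_; not)
open import Data.List using (List; []; _∷_; length)
open import Data.List.Membership.Propositional using (_∈_)
open import Data.List.Relation.Unary.Unique.Propositional using (Unique)
open import Data.Product using (Σ; _×_; ∃; ∃-syntax)
open import Data.Empty using (⊥)
open import Data.Unit using (⊤)
open import Relation.Nullary using (¬_)
open import Relation.Binary.PropositionalEquality using (_≡_; _≢_)
open import Function.Bundles using (_⤖_; Bijection)

record Graph (n : ℕ) : Set where
  field
    adj    : Fin n → Fin n → Bool
    sym    : ∀ x y → adj x y ≡ adj y x
    irrefl : ∀ x → adj x x ≡ false

open Graph public

module _ {n : ℕ} (G : Graph n) where

  Adj : Fin n → Fin n → Set
  Adj x y = adj G x y ≡ true

  data WalkIn (P : Fin n → Set) : Fin n → Fin n → Set where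
    stop : ∀ {x} → P x → WalkIn P x x
    step : ∀ {x y z} → P x → Adj x y → WalkIn P y z → WalkIn P x z

  InducedConnected : (Fin n → Set) → Set
  InducedConnected P = ∀ x y → P x → P y → WalkIn P x y

  InducedComplete : (Fin n → Set) → Set
  InducedComplete P = ∀ x y → P x → P y → x ≢ y → Adj x y

  Connected : Set
  Connected = InducedConnected (λ _ → ⊤)

  ClawFree : Set
  ClawFree = ¬ (Σ (Fin n) λ c → Σ (Fin n) λ a → Σ (Fin n) λ b → Σ (Fin n) λ d →
    Adj c a × Adj c b × Adj c d ×
    a ≢ b × a ≢ d × b ≢ d ×
    ¬ Adj a b × ¬ Adj a d × ¬ Adj b d)

  ConsecAdj : List (Fin n) → Set
  ConsecAdj [] = ⊤
  ConsecAdj (x ∷ []) = ⊤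
  ConsecAdj (x ∷ y ∷ xs) = Adj x y × ConsecAdj (y ∷ xs)

  IsHamiltonPath : List (Fin n) → Set
  IsHamiltonPath p = Unique p × (∀ v → v ∈ p) × ConsecAdj p

  Traceable : Set
  Traceable = ∃[ p ] IsHamiltonPath p

  Eligible : Fin n → Set
  Eligible x = InducedConnected (Adj x) × ¬ InducedComplete (Adj x)

  -- closed: no eligible vertex (equivalently cl(G) = G)
  Closed : Set
  Closed = ∀ x → ¬ Eligible x

  IsClique : List (Fin n) → Set
  IsClique K = Unique K × (∀ x y → x ∈ K → y ∈ K → x ≢ y → Adj x y)

  CliqueNumberAtLeast : ℕ → Set
  CliqueNumberAtLeast k = ∃[ K ] (IsClique K × k ≤ length K)

-- Adjacency of EN_n (n ≥ 6) on Fin n: vertices 0 … n-4 form K_{n-3};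
-- vertex (n-3)+i is a pendant vertex attached to vertex i, for i = 0,1,2.
enAdjℕ : ℕ → ℕ → ℕ → Bool
enAdjℕ n a b =
  let m = n ∸ 3 in
  ((a <ᵇ m) ∧ (b <ᵇ m) ∧ not (a ≡ᵇ b))
  ∨ (not (a <ᵇ m) ∧ (b ≡ᵇ (a ∸ m)))
  ∨ (not (b <ᵇ m) ∧ (a ≡ᵇ (b ∸ m)))

enAdj : (n : ℕ) → Fin n → Fin n → Bool
enAdj n x y = enAdjℕ n (toℕ x) (toℕ y)

IsoEN : {n : ℕ} → Graph n → Set
IsoEN {n} G = Σ (Fin n ⤖ Fin n) λ f →
  ∀ x y → adj G x y ≡ enAdj n (Bijection.to f x) (Bijection.to f y)

-- Fix a clique K with |K| ≥ n − 3; at most three vertices lie outside K.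
-- Since K is complete, a path that reaches a vertex of K and then stops or
-- continues in K can absorb every clique vertex not yet visited
-- ('traceable-splice').  A case analysis on the outside vertices (how many,
-- and how they are joined to each other and to K) then produces a Hamilton
-- path in every configuration but one: three pairwise non-adjacent outside
-- vertices r, s, t, each with exactly one neighbour in K, these neighbours
-- a, b, c being distinct ('ENShape').  Claw-freeness drives almost every
-- step; closedness is used once, to show that an outside vertex has at most
-- one neighbour in K ('neighbourhood-complete').  Finally a permutation of
-- Fin n sending a, b, c to 0, 1, 2, r, s, t to n−3, n−2, n−1 and K onto
-- {0, …, n−4} carries G onto EN_n ('ENIsomorphism').
module Submission where

open import Defs hiding (sym)
open import Data.Nat using (ℕ; suc; _≤_; _<_; _∸_; _+_; z≤n; s≤s; _<ᵇ_; _≡ᵇ_)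
import Data.Nat.Properties as ℕ
open import Data.Product using (Σ; _,_; _×_; proj₁; proj₂)
open import Data.Empty using (⊥; ⊥-elim)
open import Data.Unit using (⊤; tt)
open import Data.Sum using (_⊎_; inj₁; inj₂; [_,_]′; map₂)
open import Data.Fin using (Fin; toℕ; fromℕ<; _≟_)
import Data.Fin.Properties as FinP
open import Data.Fin.Permutation
  using (Permutation′; _⟨$⟩ʳ_; _⟨$⟩ˡ_; _∘ₚ_; transpose; inverseˡ) renaming (id to idₚ)
import Data.Fin.Permutation.Components as PC
open import Data.Bool using (true; false; not)
import Data.Bool.Properties as Bool
open import Data.List using (List; []; _∷_; _++_; filter; length; lookup; allFin)
open import Data.List.Properties using (length-++)
open import Data.List.Membership.Propositional using (_∈_; _∉_)
open import Data.List.Membership.Propositional.Properties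
  using (∈-++⁺ˡ; ∈-++⁺ʳ; ∈-filter⁺; ∈-filter⁻; ∈-lookup; ∈-allFin)
open import Data.List.Relation.Unary.Any using (here; there; any?)
open import Data.List.Relation.Unary.All as All using (All; []; _∷_)
open import Data.List.Relation.Unary.AllPairs using ([]; _∷_)
open import Data.List.Relation.Unary.Unique.Propositional using (Unique)
open import Data.List.Relation.Unary.Unique.Propositional.Properties using (filter⁺; ++⁺; allFin⁺)
open import Data.List.Relation.Binary.Pointwise using (Pointwise; []; _∷_)
open import Data.List.Relation.Binary.Permutation.Propositional using (_↭_; ↭-sym; ↭-trans; ↭⇒↭ₛ)
open import Data.List.Relation.Binary.Permutation.Propositional.Properties
  using (shift; shifts; ++⁺ˡ; ∈-resp-↭)
open import Data.List.Relation.Binary.Permutation.Setoid.Properties using (Unique-resp-↭)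
open import Relation.Binary.PropositionalEquality
  using (_≡_; _≢_; refl; sym; trans; cong; cong₂; subst; ≢-sym; setoid; module ≡-Reasoning)
open import Relation.Nullary using (¬_; Dec; yes; no; ¬?)
open import Relation.Nullary.Decidable using (_×-dec_; _⊎-dec_; dec-true; dec-false)
open import Function using (_∘_)
open import Function.Properties.Inverse using (↔⇒⤖)

pattern i0 = here refl
pattern i1 = there i0
pattern i2 = there i1
pattern i3 = there i2
pattern i4 = there i3
pattern i5 = there i4

_∈?_ : ∀ {m} (x : Fin m) (xs : List (Fin m)) → Dec (x ∈ xs)
x ∈? xs = any? (x ≟_) xs

module _ {A : Set} where

  unique₂ : ∀ {a b : A} → a ≢ b → Unique (a ∷ b ∷ [])
  unique₂ ab = (ab ∷ []) ∷ [] ∷ []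

  unique₃ : ∀ {a b c : A} → a ≢ b → a ≢ c → b ≢ c → Unique (a ∷ b ∷ c ∷ [])
  unique₃ ab ac bc = (ab ∷ ac ∷ []) ∷ (bc ∷ []) ∷ [] ∷ []

  unique₄ : ∀ {a b c d : A} → a ≢ b → a ≢ c → a ≢ d → b ≢ c → b ≢ d → c ≢ d →
            Unique (a ∷ b ∷ c ∷ d ∷ [])
  unique₄ ab ac ad bc bd cd = (ab ∷ ac ∷ ad ∷ []) ∷ (bc ∷ bd ∷ []) ∷ (cd ∷ []) ∷ [] ∷ []

  unique₅ : ∀ {a b c d e : A} → a ≢ b → a ≢ c → a ≢ d → a ≢ e → b ≢ c → b ≢ d → b ≢ e →
            c ≢ d → c ≢ e → d ≢ e → Unique (a ∷ b ∷ c ∷ d ∷ e ∷ [])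
  unique₅ ab ac ad ae bc bd be cd ce de =
    (ab ∷ ac ∷ ad ∷ ae ∷ []) ∷ (bc ∷ bd ∷ be ∷ []) ∷ (cd ∷ ce ∷ []) ∷ (de ∷ []) ∷ [] ∷ []

  unique₆ : ∀ {a b c d e f : A} → a ≢ b → a ≢ c → a ≢ d → a ≢ e → a ≢ f → b ≢ c → b ≢ d →
            b ≢ e → b ≢ f → c ≢ d → c ≢ e → c ≢ f → d ≢ e → d ≢ f → e ≢ f →
            Unique (a ∷ b ∷ c ∷ d ∷ e ∷ f ∷ [])
  unique₆ ab ac ad ae af bc bd be bf cd ce cf de df ef =
    (ab ∷ ac ∷ ad ∷ ae ∷ af ∷ []) ∷ (bc ∷ bd ∷ be ∷ bf ∷ []) ∷ (cd ∷ ce ∷ cf ∷ []) ∷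
    (de ∷ df ∷ []) ∷ (ef ∷ []) ∷ [] ∷ []

unique-length : ∀ {m} {xs : List (Fin m)} → Unique xs → length xs ≤ m
unique-length {xs = xs} u = FinP.injective⇒≤ (lookup-injective xs u)
  where
    lookup-injective : ∀ xs → Unique xs → ∀ {i j} → lookup xs i ≡ lookup xs j → i ≡ j
    lookup-injective (x ∷ xs) (_ ∷ _) {Fin.zero} {Fin.zero} _ = refl
    lookup-injective (x ∷ xs) (x∉ ∷ _) {Fin.zero} {Fin.suc j} e = ⊥-elim (All.lookup x∉ (∈-lookup j) e)
    lookup-injective (x ∷ xs) (x∉ ∷ _) {Fin.suc i} {Fin.zero} e = ⊥-elim (All.lookup x∉ (∈-lookup i) (sym e))
    lookup-injective (x ∷ xs) (_ ∷ u) {Fin.suc i} {Fin.suc j} e = cong Fin.suc (lookup-injective xs u e)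

module GraphFacts {n : ℕ} (G : Graph n) where

  adj? : ∀ x y → Dec (Adj G x y)
  adj? x y = adj G x y Bool.≟ true

  adj-sym : ∀ {x y} → Adj G x y → Adj G y x
  adj-sym {x} {y} xy = trans (Graph.sym G y x) xy

  adj-irrefl : ∀ {x} → ¬ Adj G x x
  adj-irrefl {x} xx with trans (sym (irrefl G x)) xx
  ... | ()

  non-adj-sym : ∀ {x y} → ¬ Adj G x y → ¬ Adj G y x
  non-adj-sym ¬xy yx = ¬xy (adj-sym yx)

  _++ʷ_ : ∀ {P x y z} → WalkIn G P x y → WalkIn G P y z → WalkIn G P x z
  stop _ ++ʷ q = q
  step px xy w ++ʷ q = step px xy (w ++ʷ q)

  walk-exit : ∀ {Q x y} (P : Fin n → Set) → (∀ v → Dec (P v)) → WalkIn G Q x y → P x → ¬ P y →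
              Σ (Fin n) λ u → Σ (Fin n) λ v → P u × ¬ P v × Adj G u v
  walk-exit P P? (stop _) px ¬py = ⊥-elim (¬py px)
  walk-exit P P? (step {y = w} _ xw rest) px ¬py with P? w
  ... | yes pw = walk-exit P P? rest pw ¬py
  ... | no ¬pw = _ , w , px , ¬pw , xw

  star-connected : ∀ P h → P h → (∀ u → P u → u ≡ h ⊎ Adj G u h) → InducedConnected G P
  star-connected P h ph near x y px py = to-hub x px (near x px) ++ʷ from-hub y py (near y py)
    where
      to-hub : ∀ u → P u → u ≡ h ⊎ Adj G u h → WalkIn G P u h
      to-hub u pu (inj₁ refl) = stop pu
      to-hub u pu (inj₂ uh) = step pu uh (stop ph)
      from-hub : ∀ v → P v → v ≡ h ⊎ Adj G v h → WalkIn G P h v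
      from-hub v pv (inj₁ refl) = stop pv
      from-hub v pv (inj₂ vh) = step ph (adj-sym vh) (stop pv)

  closed-complete : Closed G → ∀ x → InducedConnected G (Adj G x) → InducedComplete G (Adj G x)
  closed-complete closed x conn u v xu xv u≢v with adj? u v
  ... | yes uv = uv
  ... | no ¬uv = ⊥-elim (closed x (conn , λ complete → ¬uv (complete u v xu xv u≢v)))

-- Because K is complete, the clique vertices a
-- path misses can be inserted right after any clique vertex a on it,
-- provided the path stops at a or continues with another clique vertex.
module CliquePaths {n : ℕ} (G : Graph n) (K : List (Fin n)) (K-unique : Unique K)
  (K-clique : ∀ x y → x ∈ K → y ∈ K → x ≢ y → Adj G x y) where

  open GraphFacts G

  CoversOutside : List (Fin n) → Set
  CoversOutside S = ∀ v → v ∉ K → v ∈ S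

  StartsInK : List (Fin n) → Set
  StartsInK [] = ⊤
  StartsInK (q ∷ _) = q ∈ K

  traceable-direct : ∀ S → Unique S → ConsecAdj G S → CoversOutside S → (∀ m → m ∈ K → m ∈ S) →
                     Traceable G
  traceable-direct S unique consec covers K⊆S = S , unique , all-in , consec
    where
      all-in : ∀ v → v ∈ S
      all-in v with v ∈? K
      ... | yes v∈K = K⊆S v v∈K
      ... | no v∉K = covers v v∉K

  clique-run : ∀ L Q → Unique (L ++ Q) → (∀ m → m ∈ L → m ∈ K) → StartsInK Q → ConsecAdj G Q →
               ConsecAdj G (L ++ Q)
  clique-run [] Q _ _ _ consec = consec
  clique-run (m ∷ []) [] _ _ _ _ = tt
  clique-run (m ∷ []) (q ∷ Q) ((m≢ ∷ _) ∷ _) L⊆K q∈K consec =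
    K-clique m q (L⊆K m i0) q∈K m≢ , consec
  clique-run (m ∷ m′ ∷ L) Q ((m≢ ∷ _) ∷ unique) L⊆K Q₀ consec =
    K-clique m m′ (L⊆K m i0) (L⊆K m′ i1) m≢ ,
    clique-run (m′ ∷ L) Q unique (λ v v∈ → L⊆K v (there v∈)) Q₀ consec

  unique-suffix : ∀ P {X : List (Fin n)} → Unique (P ++ X) → Unique X
  unique-suffix [] unique = unique
  unique-suffix (p ∷ P) (_ ∷ unique) = unique-suffix P unique

  consec-tail : ∀ a Q → ConsecAdj G (a ∷ Q) → ConsecAdj G Q
  consec-tail a [] _ = tt
  consec-tail a (q ∷ Q) (_ , consec) = consec

  consec-suffix : ∀ P a Q → ConsecAdj G (P ++ a ∷ Q) → ConsecAdj G (a ∷ Q)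
  consec-suffix [] a Q consec = consec
  consec-suffix (p ∷ []) a Q (_ , consec) = consec
  consec-suffix (p ∷ p′ ∷ P) a Q (_ , consec) = consec-suffix (p′ ∷ P) a Q consec

  consec-replace : ∀ P a Q R → ConsecAdj G (P ++ a ∷ Q) → ConsecAdj G (a ∷ R) → ConsecAdj G (P ++ a ∷ R)
  consec-replace [] a Q R _ consec = consec
  consec-replace (p ∷ []) a Q R (pa , _) consec = pa , consec
  consec-replace (p ∷ p′ ∷ P) a Q R (pp′ , old) consec = pp′ , consec-replace (p′ ∷ P) a Q R old consec

  -- Splicing: a path P · a · Q through all outside vertices, with a ∈ K and Q
  -- empty or starting in K, extends to a Hamilton path P · a · M · Q, where M
  -- lists the clique vertices not yet visited.
  traceable-splice : ∀ P a Q → a ∈ K → StartsInK Q → Unique (P ++ a ∷ Q) → ConsecAdj G (P ++ a ∷ Q) →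
                     CoversOutside (P ++ a ∷ Q) → Traceable G
  traceable-splice P a Q a∈K Q₀ unique consec covers =
    traceable-direct (P ++ a ∷ M ++ Q) unique′ consec′ covers′ K⊆
    where
      S : List (Fin n)
      S = P ++ a ∷ Q
      fresh? : ∀ v → Dec (v ∉ S)
      fresh? v = ¬? (v ∈? S)
      M : List (Fin n)
      M = filter fresh? K
      M-fresh : ∀ {m} → m ∈ M → m ∈ K × m ∉ S
      M-fresh m∈ = ∈-filter⁻ fresh? {xs = K} m∈
      reorder : P ++ a ∷ M ++ Q ↭ M ++ S
      reorder = ↭-trans (++⁺ˡ P (↭-sym (shift a M Q))) (shifts P M)
      unique-MS : Unique (M ++ S)
      unique-MS = ++⁺ (filter⁺ fresh? K-unique) unique (λ (m∈M , m∈S) → proj₂ (M-fresh m∈M) m∈S)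
      unique′ : Unique (P ++ a ∷ M ++ Q)
      unique′ = Unique-resp-↭ (setoid (Fin n)) (↭⇒↭ₛ (↭-sym reorder)) unique-MS
      in-S : ∀ {v} → v ∈ S → v ∈ P ++ a ∷ M ++ Q
      in-S v∈S = ∈-resp-↭ (↭-sym reorder) (∈-++⁺ʳ M v∈S)
      covers′ : CoversOutside (P ++ a ∷ M ++ Q)
      covers′ v v∉K = in-S (covers v v∉K)
      K⊆ : ∀ m → m ∈ K → m ∈ P ++ a ∷ M ++ Q
      K⊆ m m∈K with m ∈? S
      ... | yes m∈S = in-S m∈S
      ... | no m∉S = ∈-resp-↭ (↭-sym reorder) (∈-++⁺ˡ (∈-filter⁺ fresh? m∈K m∉S))
      unique-aMQ : Unique ((a ∷ M) ++ Q)
      unique-aMQ = unique-suffix P unique′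
      aM⊆K : ∀ m → m ∈ a ∷ M → m ∈ K
      aM⊆K m i0 = a∈K
      aM⊆K m (there m∈M) = proj₁ (M-fresh m∈M)
      consec′ : ConsecAdj G (P ++ a ∷ M ++ Q)
      consec′ = consec-replace P a Q (M ++ Q) consec
        (clique-run (a ∷ M) Q unique-aMQ aM⊆K Q₀ (consec-tail a Q (consec-suffix P a Q consec)))

  covers-via : ∀ {R S} → (∀ v → v ∈ K ⊎ v ∈ R) → (∀ {v} → v ∈ R → v ∈ S) → CoversOutside S
  covers-via cover R⊆S v v∉K with cover v
  ... | inj₁ v∈K = ⊥-elim (v∉K v∈K)
  ... | inj₂ v∈R = R⊆S v∈R

  outside≢inside : ∀ {v m} → v ∉ K → m ∈ K → v ≢ m
  outside≢inside v∉K m∈K refl = v∉K m∈K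

  inside≢outside : ∀ {m v} → m ∈ K → v ∉ K → m ≢ v
  inside≢outside m∈K v∉K refl = v∉K m∈K

  record Outside3 (x y z : Fin n) : Set where
    field
      x∉K : x ∉ K
      y∉K : y ∉ K
      z∉K : z ∉ K
      x≢y : x ≢ y
      x≢z : x ≢ z
      y≢z : y ≢ z
      cover : ∀ v → v ∈ K ⊎ v ∈ x ∷ y ∷ z ∷ []

  swap₁₂ : ∀ {x y z} → Outside3 x y z → Outside3 y x z
  swap₁₂ ρ = record
    { x∉K = y∉K ; y∉K = x∉K ; z∉K = z∉K ; x≢y = ≢-sym x≢y ; x≢z = y≢z ; y≢z = x≢z
    ; cover = λ v → map₂ (λ { i0 → i1 ; i1 → i0 ; i2 → i2 ; (there (there (there ()))) }) (cover v) }
    where open Outside3 ρ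

  swap₂₃ : ∀ {x y z} → Outside3 x y z → Outside3 x z y
  swap₂₃ ρ = record
    { x∉K = x∉K ; y∉K = z∉K ; z∉K = y∉K ; x≢y = x≢z ; x≢z = x≢y ; y≢z = ≢-sym y≢z
    ; cover = λ v → map₂ (λ { i0 → i0 ; i1 → i2 ; i2 → i1 ; (there (there (there ()))) }) (cover v) }
    where open Outside3 ρ

  swap₁₃ : ∀ {x y z} → Outside3 x y z → Outside3 z y x
  swap₁₃ ρ = swap₂₃ (swap₁₂ (swap₂₃ ρ))

  Independent : Fin n → Fin n → Fin n → Set
  Independent x y z = ¬ Adj G x y × ¬ Adj G x z × ¬ Adj G y z

  indep₁₂ : ∀ {x y z} → Independent x y z → Independent y x z
  indep₁₂ (¬xy , ¬xz , ¬yz) = non-adj-sym ¬xy , ¬yz , ¬xz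

  indep₂₃ : ∀ {x y z} → Independent x y z → Independent x z y
  indep₂₃ (¬xy , ¬xz , ¬yz) = ¬xz , ¬xy , non-adj-sym ¬yz

  indep₁₃ : ∀ {x y z} → Independent x y z → Independent z y x
  indep₁₃ ind = indep₂₃ (indep₁₂ (indep₂₃ ind))

  record ENShape : Set where
    field
      r s t a b c : Fin n
      outside : Outside3 r s t
      independent : Independent r s t
      a∈K : a ∈ K
      b∈K : b ∈ K
      c∈K : c ∈ K
      a≢b : a ≢ b
      a≢c : a ≢ c
      b≢c : b ≢ c
      r~a : Adj G r a
      s~b : Adj G s b
      t~c : Adj G t c
      r-only-a : ∀ e → e ∈ K → Adj G r e → e ≡ a
      s-only-b : ∀ e → e ∈ K → Adj G s e → e ≡ b
      t-only-c : ∀ e → e ∈ K → Adj G t e → e ≡ c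

  module _ (E : ENShape) where
    open ENShape E
    open Outside3 outside

    en-vertices-unique : Unique (a ∷ b ∷ c ∷ r ∷ s ∷ t ∷ [])
    en-vertices-unique =
      unique₆ a≢b a≢c (inside≢outside a∈K x∉K) (inside≢outside a∈K y∉K) (inside≢outside a∈K z∉K)
        b≢c (inside≢outside b∈K x∉K) (inside≢outside b∈K y∉K) (inside≢outside b∈K z∉K)
        (inside≢outside c∈K x∉K) (inside≢outside c∈K y∉K) (inside≢outside c∈K z∉K) x≢y x≢z y≢z

    outside-independent : ∀ {w w′} → w ∉ K → w′ ∉ K → ¬ Adj G w w′
    outside-independent {w} {w′} w∉K w′∉K with cover w | cover w′
    ... | inj₁ w∈K | _ = ⊥-elim (w∉K w∈K)
    ... | _ | inj₁ w′∈K = ⊥-elim (w′∉K w′∈K)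
    ... | inj₂ i0 | inj₂ i0 = adj-irrefl
    ... | inj₂ i0 | inj₂ i1 = proj₁ independent
    ... | inj₂ i0 | inj₂ i2 = proj₁ (proj₂ independent)
    ... | inj₂ i1 | inj₂ i0 = non-adj-sym (proj₁ independent)
    ... | inj₂ i1 | inj₂ i1 = adj-irrefl
    ... | inj₂ i1 | inj₂ i2 = proj₂ (proj₂ independent)
    ... | inj₂ i2 | inj₂ i0 = non-adj-sym (proj₁ (proj₂ independent))
    ... | inj₂ i2 | inj₂ i1 = non-adj-sym (proj₂ (proj₂ independent))
    ... | inj₂ i2 | inj₂ i2 = adj-irrefl

module NonTraceable {n : ℕ} (G : Graph n) (connected : Connected G) (closed : Closed G)
  (claw-free : ClawFree G) (non-traceable : Traceable G → ⊥)
  (K : List (Fin n)) (K-unique : Unique K) (K-clique : ∀ x y → x ∈ K → y ∈ K → x ≢ y → Adj G x y) where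

  open GraphFacts G
  open CliquePaths G K K-unique K-clique

  no-claw : ∀ {c a b d} → Adj G c a → Adj G c b → Adj G c d → a ≢ b → a ≢ d → b ≢ d →
            ¬ Adj G a b → ¬ Adj G a d → ¬ Adj G b d → ⊥
  no-claw ca cb cd a≢b a≢d b≢d ¬ab ¬ad ¬bd =
    claw-free (_ , _ , _ , _ , ca , cb , cd , a≢b , a≢d , b≢d , ¬ab , ¬ad , ¬bd)

  HasKNbr : Fin n → Set
  HasKNbr x = Σ (Fin n) λ c → c ∈ K × Adj G x c

  has-K-nbr? : ∀ x → Dec (HasKNbr x)
  has-K-nbr? x = FinP.any? (λ c → (c ∈? K) ×-dec adj? x c)

  OtherInK : (Fin n → Set) → Fin n → Set
  OtherInK P a = Σ (Fin n) λ k → (k ∈ K × k ≢ a) × P k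

  other-in-K? : ∀ {P : Fin n → Set} → (∀ v → Dec (P v)) → ∀ a → Dec (OtherInK P a)
  other-in-K? P? a = FinP.any? (λ k → ((k ∈? K) ×-dec ¬? (k ≟ a)) ×-dec P? k)

  no-other-in-K : ∀ {P : Fin n → Set} {a} → ¬ OtherInK P a → ∀ k → k ∈ K → P k → k ≡ a
  no-other-in-K {a = a} none k k∈K pk with k ≟ a
  ... | yes k≡a = k≡a
  ... | no k≢a = ⊥-elim (none (k , (k∈K , k≢a) , pk))

  K-neighbour : ∀ x y → x ≢ y → (∀ w → w ∉ K → ¬ Adj G x w) → HasKNbr x
  K-neighbour x y x≢y no-outside-nbr with connected x y tt tt
  ... | stop _ = ⊥-elim (x≢y refl)
  ... | step {y = w} _ xw _ with w ∈? K
  ...   | yes w∈K = w , w∈K , xw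
  ...   | no w∉K = ⊥-elim (no-outside-nbr w w∉K xw)

  edge-into-K : (P : Fin n → Set) → (∀ v → Dec (P v)) → (∀ v → P v → v ∉ K) →
                (∀ u v → P u → ¬ P v → v ∉ K → ¬ Adj G u v) →
                ∀ {x m} → P x → m ∈ K → Σ (Fin n) λ u → P u × HasKNbr u
  edge-into-K P P? P-outside closed-off {x} {m} px m∈K
    with walk-exit P P? (connected x m tt tt) px (λ pm → P-outside m pm m∈K)
  ... | u , v , pu , ¬pv , uv with v ∈? K
  ...   | yes v∈K = u , pu , v , v∈K , uv
  ...   | no v∉K = ⊥-elim (closed-off u v pu ¬pv v∉K uv)

  K-empty : ∀ {R x} → (∀ v → v ∈ K ⊎ v ∈ R) → (∀ {u} → u ∈ R → ¬ HasKNbr u) → x ∉ K → ∀ m → m ∉ K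
  K-empty cover isolated x∉K m m∈K
    with edge-into-K (_∉ K) (λ v → ¬? (v ∈? K)) (λ _ v∉K → v∉K) (λ _ _ _ ¬v∉K v∉K _ → ¬v∉K v∉K) x∉K m∈K
  ... | u , u∉K , nbr with cover u
  ...   | inj₁ u∈K = u∉K u∈K
  ...   | inj₂ u∈R = isolated u∈R nbr

  -- Two non-adjacent outside vertices x, z with neighbours in K either have
  -- distinct neighbours in K, or K is a single common neighbour of both: a
  -- second vertex k of K would give the claw (a; x, z, k).
  data EndsInK (x z : Fin n) : Set where
    distinct-ends : ∀ {a b} → a ∈ K → b ∈ K → a ≢ b → Adj G x a → Adj G z b → EndsInK x z
    common-end : ∀ {a} → a ∈ K → (∀ k → k ∈ K → k ≡ a) → Adj G x a → Adj G z a → EndsInK x z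

  ends-in-K : ∀ {x z} → x ∉ K → z ∉ K → x ≢ z → ¬ Adj G x z → HasKNbr x → HasKNbr z → EndsInK x z
  ends-in-K {x} {z} x∉K z∉K x≢z ¬xz (a , a∈K , xa) (b , b∈K , zb) with a ≟ b
  ... | no a≢b = distinct-ends a∈K b∈K a≢b xa zb
  ... | yes refl with other-in-K? (adj? z) a
  ...   | yes (b′ , (b′∈K , b′≢a) , zb′) = distinct-ends a∈K b′∈K (≢-sym b′≢a) xa zb′
  ...   | no z-only-a with other-in-K? (adj? x) a
  ...     | yes (a′ , (a′∈K , a′≢a) , xa′) = distinct-ends a′∈K a∈K a′≢a xa′ zb
  ...     | no x-only-a with other-in-K? (λ _ → yes tt) a
  ...       | no K-is-a = common-end a∈K (λ k k∈K → no-other-in-K K-is-a k k∈K tt) xa zb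
  ...       | yes (k , (k∈K , k≢a) , _) =
    ⊥-elim (no-claw (adj-sym xa) (adj-sym zb) (K-clique a k a∈K k∈K (≢-sym k≢a))
      x≢z (outside≢inside x∉K k∈K) (outside≢inside z∉K k∈K)
      ¬xz (λ xk → x-only-a (k , (k∈K , k≢a) , xk)) (λ zk → z-only-a (k , (k∈K , k≢a) , zk)))

  outside-nbrs : ∀ {R x} → (∀ v → v ∈ K ⊎ v ∈ R) → (∀ {w} → w ∈ R → ¬ Adj G x w) →
                 ∀ w → w ∉ K → ¬ Adj G x w
  outside-nbrs cover not-in-R w w∉K xw with cover w
  ... | inj₁ w∈K = w∉K w∈K
  ... | inj₂ w∈R = not-in-R w∈R xw

  -- No vertex outside K: splice all of K after any single vertex (or, if
  -- there is no vertex at all, the empty path is Hamiltonian).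
  no-outside : (∀ v → v ∈ K) → ⊥
  no-outside all-K with FinP.any? {P = λ _ → ⊤} (λ _ → yes tt)
  ... | yes (v , _) =
    non-traceable (traceable-splice [] v [] (all-K v) tt ([] ∷ []) tt (λ w w∉K → ⊥-elim (w∉K (all-K w))))
  ... | no no-vertex = non-traceable ([] , [] , (λ v → ⊥-elim (no-vertex (v , tt))) , tt)

  -- One outside vertex r: attach r to K; if r has no neighbour in K then K
  -- is empty and r alone is the graph.
  one-outside : ∀ {r} → r ∉ K → (∀ v → v ∈ K ⊎ v ∈ r ∷ []) → ⊥
  one-outside {r} r∉K cover with has-K-nbr? r
  ... | yes (c , c∈K , rc) =
    non-traceable (traceable-splice (r ∷ []) c [] c∈K tt (unique₂ (outside≢inside r∉K c∈K)) (rc , tt)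
      (covers-via cover λ { i0 → i0 ; (there ()) }))
  ... | no ¬r-nbr =
    non-traceable (traceable-direct (r ∷ []) ([] ∷ []) tt (covers-via cover λ r∈ → r∈)
      (λ m m∈K → ⊥-elim (K-empty cover (λ { i0 → ¬r-nbr ; (there ()) }) r∉K m m∈K)))

  -- Two adjacent outside vertices r – s: continue into K from whichever end
  -- has a neighbour there; if neither has one, K is empty.
  two-adjacent-outside : ∀ {r s} → r ∉ K → s ∉ K → r ≢ s → (∀ v → v ∈ K ⊎ v ∈ r ∷ s ∷ []) →
                         Adj G r s → ⊥
  two-adjacent-outside {r} {s} r∉K s∉K r≢s cover rs with has-K-nbr? s | has-K-nbr? r
  ... | yes (c , c∈K , sc) | _ =
    non-traceable (traceable-splice (r ∷ s ∷ []) c [] c∈K tt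
      (unique₃ r≢s (outside≢inside r∉K c∈K) (outside≢inside s∉K c∈K)) (rs , sc , tt)
      (covers-via cover λ { i0 → i0 ; i1 → i1 ; (there (there ())) }))
  ... | no _ | yes (c , c∈K , rc) =
    non-traceable (traceable-splice (s ∷ r ∷ []) c [] c∈K tt
      (unique₃ (≢-sym r≢s) (outside≢inside s∉K c∈K) (outside≢inside r∉K c∈K)) (adj-sym rs , rc , tt)
      (covers-via cover λ { i0 → i1 ; i1 → i0 ; (there (there ())) }))
  ... | no ¬s-nbr | no ¬r-nbr =
    non-traceable (traceable-direct (r ∷ s ∷ []) (unique₂ r≢s) (rs , tt) (covers-via cover λ v∈ → v∈)
      (λ m m∈K → ⊥-elim (K-empty cover isolated r∉K m m∈K)))
    where
      isolated : ∀ {u} → u ∈ r ∷ s ∷ [] → ¬ HasKNbr u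
      isolated = λ { i0 → ¬r-nbr ; i1 → ¬s-nbr ; (there (there ())) }

  -- Two non-adjacent outside vertices r, s: go r · a · (rest of K) · b · s
  -- through distinct K-neighbours a, b, or r · a · s when K = {a}.
  two-outside : ∀ {r s} → r ∉ K → s ∉ K → r ≢ s → (∀ v → v ∈ K ⊎ v ∈ r ∷ s ∷ []) → ⊥
  two-outside {r} {s} r∉K s∉K r≢s cover with adj? r s
  ... | yes rs = two-adjacent-outside r∉K s∉K r≢s cover rs
  ... | no ¬rs
    with ends-in-K r∉K s∉K r≢s ¬rs
           (K-neighbour r s r≢s (outside-nbrs cover λ { i0 → adj-irrefl ; i1 → ¬rs ; (there (there ())) }))
           (K-neighbour s r (≢-sym r≢s)
             (outside-nbrs cover λ { i0 → non-adj-sym ¬rs ; i1 → adj-irrefl ; (there (there ())) }))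
  ... | distinct-ends {a} {b} a∈K b∈K a≢b ra sb =
    non-traceable (traceable-splice (r ∷ []) a (b ∷ s ∷ []) a∈K b∈K
      (unique₄ (outside≢inside r∉K a∈K) (outside≢inside r∉K b∈K) r≢s a≢b
        (inside≢outside a∈K s∉K) (inside≢outside b∈K s∉K))
      (ra , K-clique a b a∈K b∈K a≢b , adj-sym sb , tt)
      (covers-via cover λ { i0 → i0 ; i1 → i3 ; (there (there ())) }))
  ... | common-end {a} a∈K K-is-a ra sa =
    non-traceable (traceable-direct (r ∷ a ∷ s ∷ [])
      (unique₃ (outside≢inside r∉K a∈K) r≢s (inside≢outside a∈K s∉K)) (ra , adj-sym sa , tt)
      (covers-via cover λ { i0 → i0 ; i1 → i2 ; (there (there ())) })
      (λ m m∈K → subst (_∈ _) (sym (K-is-a m m∈K)) i1))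

  module _ {x y z : Fin n} (ρ : Outside3 x y z) where
    open Outside3 ρ

    covers₃ : ∀ {S} → x ∈ S → y ∈ S → z ∈ S → CoversOutside S
    covers₃ x∈S y∈S z∈S = covers-via cover λ { i0 → x∈S ; i1 → y∈S ; i2 → z∈S ; (there (there (there ()))) }

    -- Continue into K from an
    -- end if possible, or from y after rerouting z – x – y; a neighbour c ∈ K
    -- of y alone would give the claw (y; x, z, c).  Without any edge to K,
    -- K is empty.
    path-outside : Adj G x y → Adj G y z → ⊥
    path-outside xy yz with has-K-nbr? z | has-K-nbr? x | has-K-nbr? y
    ... | yes (c , c∈K , zc) | _ | _ =
      non-traceable (traceable-splice (x ∷ y ∷ z ∷ []) c [] c∈K tt
        (unique₄ x≢y x≢z (outside≢inside x∉K c∈K) y≢z (outside≢inside y∉K c∈K) (outside≢inside z∉K c∈K))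
        (xy , yz , zc , tt) (covers₃ i0 i1 i2))
    ... | no _ | yes (c , c∈K , xc) | _ =
      non-traceable (traceable-splice (z ∷ y ∷ x ∷ []) c [] c∈K tt
        (unique₄ (≢-sym y≢z) (≢-sym x≢z) (outside≢inside z∉K c∈K) (≢-sym x≢y)
          (outside≢inside y∉K c∈K) (outside≢inside x∉K c∈K))
        (adj-sym yz , adj-sym xy , xc , tt) (covers₃ i2 i1 i0))
    ... | no ¬z-nbr | no ¬x-nbr | no ¬y-nbr =
      non-traceable (traceable-direct (x ∷ y ∷ z ∷ []) (unique₃ x≢y x≢z y≢z) (xy , yz , tt)
        (covers₃ i0 i1 i2) (λ m m∈K → ⊥-elim (K-empty cover isolated x∉K m m∈K)))
      where
        isolated : ∀ {u} → u ∈ x ∷ y ∷ z ∷ [] → ¬ HasKNbr u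
        isolated = λ { i0 → ¬x-nbr ; i1 → ¬y-nbr ; i2 → ¬z-nbr ; (there (there (there ()))) }
    ... | no ¬z-nbr | no ¬x-nbr | yes (c , c∈K , yc) with adj? x z
    ...   | yes xz =
      non-traceable (traceable-splice (z ∷ x ∷ y ∷ []) c [] c∈K tt
        (unique₄ (≢-sym x≢z) (≢-sym y≢z) (outside≢inside z∉K c∈K) x≢y
          (outside≢inside x∉K c∈K) (outside≢inside y∉K c∈K))
        (adj-sym xz , xy , yc , tt) (covers₃ i1 i2 i0))
    ...   | no ¬xz =
      no-claw (adj-sym xy) yz yc x≢z (outside≢inside x∉K c∈K) (outside≢inside z∉K c∈K)
        ¬xz (λ xc → ¬x-nbr (c , c∈K , xc)) (λ zc → ¬z-nbr (c , c∈K , zc))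

    -- Three outside vertices with the single edge x – y, where x has a
    -- neighbour in K: route y · x · a · (rest of K) · b · z through distinct
    -- K-neighbours a of x and b of z, or y · x · a · z when K = {a}.
    edge-outside-at : Adj G x y → ¬ Adj G x z → ¬ Adj G y z → HasKNbr x → ⊥
    edge-outside-at xy ¬xz ¬yz x-nbr with ends-in-K x∉K z∉K x≢z ¬xz x-nbr z-nbr
      where
        z-nbr : HasKNbr z
        z-nbr = K-neighbour z x (≢-sym x≢z) (outside-nbrs cover
          λ { i0 → non-adj-sym ¬xz ; i1 → non-adj-sym ¬yz ; i2 → adj-irrefl ; (there (there (there ()))) })
    ... | distinct-ends {a} {b} a∈K b∈K a≢b xa zb =
      non-traceable (traceable-splice (y ∷ x ∷ []) a (b ∷ z ∷ []) a∈K b∈K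
        (unique₅ (≢-sym x≢y) (outside≢inside y∉K a∈K) (outside≢inside y∉K b∈K) y≢z
          (outside≢inside x∉K a∈K) (outside≢inside x∉K b∈K) x≢z a≢b
          (inside≢outside a∈K z∉K) (inside≢outside b∈K z∉K))
        (adj-sym xy , xa , K-clique a b a∈K b∈K a≢b , adj-sym zb , tt) (covers₃ i1 i0 i4))
    ... | common-end {a} a∈K K-is-a xa za =
      non-traceable (traceable-direct (y ∷ x ∷ a ∷ z ∷ [])
        (unique₄ (≢-sym x≢y) (outside≢inside y∉K a∈K) y≢z (outside≢inside x∉K a∈K) x≢z
          (inside≢outside a∈K z∉K))
        (adj-sym xy , xa , adj-sym za , tt) (covers₃ i1 i0 i3)
        (λ m m∈K → subst (_∈ _) (sym (K-is-a m m∈K)) i2))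

  -- The set {x, y} has
  -- no edge to z, so (K being non-empty, as z has a neighbour in K) one of
  -- x, y has a neighbour in K; by symmetry it is x.
  edge-outside : ∀ {x y z} → Outside3 x y z → Adj G x y → ¬ Adj G x z → ¬ Adj G y z → ⊥
  edge-outside {x} {y} {z} ρ xy ¬xz ¬yz with z-nbr
    where
      open Outside3 ρ
      z-nbr : HasKNbr z
      z-nbr = K-neighbour z x (≢-sym x≢z) (outside-nbrs cover
        λ { i0 → non-adj-sym ¬xz ; i1 → non-adj-sym ¬yz ; i2 → adj-irrefl ; (there (there (there ()))) })
  ... | b , b∈K , _ with edge-into-K (λ v → v ≡ x ⊎ v ≡ y) (λ v → (v ≟ x) ⊎-dec (v ≟ y))
                           x-or-y-outside closed-off (inj₁ refl) b∈K
    where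
      open Outside3 ρ
      x-or-y-outside : ∀ v → v ≡ x ⊎ v ≡ y → v ∉ K
      x-or-y-outside v (inj₁ refl) = x∉K
      x-or-y-outside v (inj₂ refl) = y∉K
      closed-off : ∀ u v → u ≡ x ⊎ u ≡ y → ¬ (v ≡ x ⊎ v ≡ y) → v ∉ K → ¬ Adj G u v
      closed-off u v u-xy v-not-xy v∉K with cover v
      ... | inj₁ v∈K = ⊥-elim (v∉K v∈K)
      ... | inj₂ i0 = ⊥-elim (v-not-xy (inj₁ refl))
      ... | inj₂ i1 = ⊥-elim (v-not-xy (inj₂ refl))
      closed-off u v (inj₁ refl) _ _ | inj₂ i2 = ¬xz
      closed-off u v (inj₂ refl) _ _ | inj₂ i2 = ¬yz
  ... | u , inj₁ refl , u-nbr = edge-outside-at ρ xy ¬xz ¬yz u-nbr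
  ... | u , inj₂ refl , u-nbr = edge-outside-at (swap₁₂ ρ) (adj-sym xy) ¬yz ¬xz u-nbr

  TwoKNbrs : Fin n → Set
  TwoKNbrs y = Σ (Fin n) λ b → Σ (Fin n) λ c → ((b ∈ K × c ∈ K) × b ≢ c) × (Adj G y b × Adj G y c)

  SharedKNbr : Fin n → Fin n → Set
  SharedKNbr y z = Σ (Fin n) λ c → c ∈ K × (Adj G y c × Adj G z c)

  shared-K-nbr? : ∀ y z → Dec (SharedKNbr y z)
  shared-K-nbr? y z = FinP.any? λ c → (c ∈? K) ×-dec (adj? y c ×-dec adj? z c)

  other-K-nbr : ∀ {y} → TwoKNbrs y → ∀ c → OtherInK (Adj G y) c
  other-K-nbr (b , b′ , ((b∈K , b′∈K) , b≢b′) , yb , yb′) c with b ≟ c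
  ... | yes refl = b′ , (b′∈K , ≢-sym b≢b′) , yb′
  ... | no b≢c = b , (b∈K , b≢c) , yb

  sole-K-nbr : ∀ {x a} → ¬ TwoKNbrs x → a ∈ K → Adj G x a → ∀ e → e ∈ K → Adj G x e → e ≡ a
  sole-K-nbr {a = a} ¬two a∈K xa e e∈K xe with e ≟ a
  ... | yes e≡a = e≡a
  ... | no e≢a = ⊥-elim (¬two (e , a , ((e∈K , a∈K) , e≢a) , xe , xa))

  module _ {x y z : Fin n} (ρ : Outside3 x y z) (ind : Independent x y z) where
    open Outside3 ρ
    ¬xy : ¬ Adj G x y
    ¬xy = proj₁ ind
    ¬xz : ¬ Adj G x z
    ¬xz = proj₁ (proj₂ ind)
    ¬yz : ¬ Adj G y z
    ¬yz = proj₂ (proj₂ ind)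

    independent-K-nbr : HasKNbr x
    independent-K-nbr = K-neighbour x y x≢y (outside-nbrs cover
      λ { i0 → adj-irrefl ; i1 → ¬xy ; i2 → ¬xz ; (there (there (there ()))) })

    -- By the
    -- claw (c; x, y, z), x is not adjacent to c; then G is traceable, via
    -- another K-neighbour of x if there is one ('via-other-nbr'), and via b
    -- itself otherwise ('via-sole-nbr').
    module _ {b c : Fin n} (b∈K : b ∈ K) (c∈K : c ∈ K) (b≢c : b ≢ c)
             (yb : Adj G y b) (yc : Adj G y c) (zc : Adj G z c) where

      x≁c : ¬ Adj G x c
      x≁c xc = no-claw (adj-sym xc) (adj-sym yc) (adj-sym zc) x≢y x≢z y≢z ¬xy ¬xz ¬yz

      x≢ : ∀ {k} → k ∈ K → x ≢ k
      x≢ = outside≢inside x∉K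
      ≢y : ∀ {k} → k ∈ K → k ≢ y
      ≢y k∈K = inside≢outside k∈K y∉K
      ≢z : ∀ {k} → k ∈ K → k ≢ z
      ≢z k∈K = inside≢outside k∈K z∉K

      -- x · a · (rest of K) · b · y · c · z
      via-other-nbr : OtherInK (Adj G x) b → ⊥
      via-other-nbr (a , (a∈K , a≢b) , xa) =
        non-traceable (traceable-splice (x ∷ []) a (b ∷ y ∷ c ∷ z ∷ []) a∈K b∈K
          (unique₆ (x≢ a∈K) (x≢ b∈K) x≢y (x≢ c∈K) x≢z a≢b (≢y a∈K) (λ { refl → x≁c xa }) (≢z a∈K)
            (≢y b∈K) b≢c (≢z b∈K) (≢-sym (≢y c∈K)) y≢z (≢z c∈K))
          (xa , K-clique a b a∈K b∈K a≢b , adj-sym yb , yc , adj-sym zc , tt) (covers₃ ρ i0 i3 i5))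

      -- if b is the only K-neighbour of x, y sees all of K − b: a non-neighbour
      -- k would give the claw (b; x, y, k)
      y-sees-K : Adj G x b → ¬ OtherInK (Adj G x) b → ∀ k → k ∈ K → k ≢ b → Adj G y k
      y-sees-K xb x-only-b k k∈K k≢b with adj? y k
      ... | yes yk = yk
      ... | no ¬yk = ⊥-elim (no-claw (adj-sym xb) (adj-sym yb) (K-clique b k b∈K k∈K (≢-sym k≢b))
              x≢y (x≢ k∈K) (≢-sym (≢y k∈K)) ¬xy (λ xk → x-only-b (k , (k∈K , k≢b) , xk)) ¬yk)

      -- x · b · (rest of K) · d · y · c · z, or x · b · y · c · z when K = {b, c}
      via-sole-nbr : Adj G x b → ¬ OtherInK (Adj G x) b → ⊥
      via-sole-nbr xb x-only-b with other-in-K? (λ d → ¬? (d ≟ c)) b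
      ... | yes (d , (d∈K , d≢b) , d≢c) =
        non-traceable (traceable-splice (x ∷ []) b (d ∷ y ∷ c ∷ z ∷ []) b∈K d∈K
          (unique₆ (x≢ b∈K) (x≢ d∈K) x≢y (x≢ c∈K) x≢z (≢-sym d≢b) (≢y b∈K) b≢c (≢z b∈K)
            (≢y d∈K) d≢c (≢z d∈K) (≢-sym (≢y c∈K)) y≢z (≢z c∈K))
          (xb , K-clique b d b∈K d∈K (≢-sym d≢b) , adj-sym (y-sees-K xb x-only-b d d∈K d≢b) ,
            yc , adj-sym zc , tt)
          (covers₃ ρ i0 i3 i5))
      ... | no K-is-bc =
        non-traceable (traceable-direct (x ∷ b ∷ y ∷ c ∷ z ∷ [])
          (unique₅ (x≢ b∈K) x≢y (x≢ c∈K) x≢z (≢y b∈K) b≢c (≢z b∈K) (≢-sym (≢y c∈K)) y≢z (≢z c∈K))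
          (xb , adj-sym yb , yc , adj-sym zc , tt) (covers₃ ρ i0 i2 i4) K⊆)
        where
          K⊆ : ∀ m → m ∈ K → m ∈ x ∷ b ∷ y ∷ c ∷ z ∷ []
          K⊆ m m∈K with m ≟ c
          ... | yes refl = i3
          ... | no m≢c = subst (_∈ _) (sym (no-other-in-K K-is-bc m m∈K m≢c)) i1

      shared-configuration-impossible : ⊥
      shared-configuration-impossible with other-in-K? (adj? x) b | independent-K-nbr
      ... | yes other | _ = via-other-nbr other
      ... | no x-only-b | a , a∈K , xa =
        via-sole-nbr (subst (Adj G x) (no-other-in-K x-only-b a a∈K xa) xa) x-only-b

    shared-neighbour-impossible : TwoKNbrs y → SharedKNbr y z → ⊥
    shared-neighbour-impossible two (c , c∈K , yc , zc) with other-K-nbr two c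
    ... | b , (b∈K , b≢c) , yb = shared-configuration-impossible b∈K c∈K b≢c yb yc zc

    -- The one use of closedness.  If y has neighbours b₀ ≠ c₀ in K and
    -- neither x nor z is adjacent to b₀, then N(b₀) ⊆ K ∪ {y} is a star
    -- around c₀, so it is connected, hence complete, and y is adjacent to
    -- every other vertex of K.
    neighbourhood-complete : ∀ {b₀ c₀} → b₀ ∈ K → c₀ ∈ K → b₀ ≢ c₀ → Adj G y b₀ → Adj G y c₀ →
                             ¬ Adj G x b₀ → ¬ Adj G z b₀ → ∀ a → a ∈ K → a ≢ b₀ → Adj G y a
    neighbourhood-complete {b₀} {c₀} b₀∈K c₀∈K b₀≢c₀ yb₀ yc₀ ¬xb₀ ¬zb₀ a a∈K a≢b₀ =
      closed-complete closed b₀ (star-connected (Adj G b₀) c₀ (K-clique b₀ c₀ b₀∈K c₀∈K b₀≢c₀) near)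
        y a (adj-sym yb₀) (K-clique b₀ a b₀∈K a∈K (≢-sym a≢b₀)) (outside≢inside y∉K a∈K)
      where
        near : ∀ u → Adj G b₀ u → u ≡ c₀ ⊎ Adj G u c₀
        near u b₀u with cover u
        ... | inj₁ u∈K with u ≟ c₀
        ...   | yes u≡c₀ = inj₁ u≡c₀
        ...   | no u≢c₀ = inj₂ (K-clique u c₀ u∈K c₀∈K u≢c₀)
        near u b₀u | inj₂ i0 = ⊥-elim (¬xb₀ (adj-sym b₀u))
        near u b₀u | inj₂ i1 = inj₂ yc₀
        near u b₀u | inj₂ i2 = ⊥-elim (¬zb₀ (adj-sym b₀u))

  -- In the independent case y has at most one neighbour in K: a neighbour
  -- shared with z or with x is excluded above; otherwise, by
  -- 'neighbourhood-complete', y is adjacent to the K-neighbour of x after all.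
  two-K-neighbours-impossible : ∀ {x y z} → Outside3 x y z → Independent x y z → ¬ TwoKNbrs y
  two-K-neighbours-impossible {x} {y} {z} ρ ind two@(b₀ , c₀ , ((b₀∈K , c₀∈K) , b₀≢c₀) , yb₀ , yc₀)
    with shared-K-nbr? y z | shared-K-nbr? y x | independent-K-nbr ρ ind
  ... | yes shared | _ | _ = shared-neighbour-impossible ρ ind two shared
  ... | no _ | yes shared | _ = shared-neighbour-impossible (swap₁₃ ρ) (indep₁₃ ind) two shared
  ... | no ¬yz-shared | no ¬yx-shared | a , a∈K , xa =
    ¬yx-shared (a , a∈K , neighbourhood-complete ρ ind b₀∈K c₀∈K b₀≢c₀ yb₀ yc₀
      (λ xb₀ → ¬yx-shared (b₀ , b₀∈K , yb₀ , xb₀)) (λ zb₀ → ¬yz-shared (b₀ , b₀∈K , yb₀ , zb₀))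
      a a∈K (λ { refl → ¬yx-shared (a , a∈K , yb₀ , xa) }) , xa)

  -- In the independent case x and y have different K-neighbours: a common
  -- neighbour a gives the claw (a; x, y, z) or (a; x, y, c) for the
  -- K-neighbour c of z.
  distinct-anchors : ∀ {x y z a c} → Outside3 x y z → Independent x y z → ¬ TwoKNbrs x → ¬ TwoKNbrs y →
                     a ∈ K → c ∈ K → Adj G x a → Adj G y a → Adj G z c → ⊥
  distinct-anchors {a = a} {c} ρ (¬xy , ¬xz , ¬yz) ¬two-x ¬two-y a∈K c∈K xa ya zc with c ≟ a
  ... | yes refl = no-claw (adj-sym xa) (adj-sym ya) (adj-sym zc) x≢y x≢z y≢z ¬xy ¬xz ¬yz
    where open Outside3 ρ
  ... | no c≢a = no-claw (adj-sym xa) (adj-sym ya) (K-clique a c a∈K c∈K (≢-sym c≢a))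
                   x≢y (outside≢inside x∉K c∈K) (outside≢inside y∉K c∈K) ¬xy
                   (λ xc → c≢a (sole-K-nbr ¬two-x a∈K xa c c∈K xc))
                   (λ yc → c≢a (sole-K-nbr ¬two-y a∈K ya c c∈K yc))
    where open Outside3 ρ

  independent-outside : ∀ {x y z} → Outside3 x y z → Independent x y z → ENShape
  independent-outside {x} {y} {z} ρ ind
    with independent-K-nbr ρ ind | independent-K-nbr (swap₁₂ ρ) (indep₁₂ ind)
       | independent-K-nbr (swap₁₃ ρ) (indep₁₃ ind)
  ... | a , a∈K , xa | b , b∈K , yb | c , c∈K , zc = record
    { r = x ; s = y ; t = z ; a = a ; b = b ; c = c
    ; outside = ρ ; independent = ind ; a∈K = a∈K ; b∈K = b∈K ; c∈K = c∈K
    ; a≢b = λ { refl → distinct-anchors ρ ind ¬two-x ¬two-y a∈K c∈K xa yb zc }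
    ; a≢c = λ { refl → distinct-anchors (swap₂₃ ρ) (indep₂₃ ind) ¬two-x ¬two-z a∈K b∈K xa zc yb }
    ; b≢c = λ { refl → distinct-anchors (swap₂₃ (swap₁₂ ρ)) (indep₂₃ (indep₁₂ ind)) ¬two-y ¬two-z
                         b∈K a∈K yb zc xa }
    ; r~a = xa ; s~b = yb ; t~c = zc
    ; r-only-a = sole-K-nbr ¬two-x a∈K xa
    ; s-only-b = sole-K-nbr ¬two-y b∈K yb
    ; t-only-c = sole-K-nbr ¬two-z c∈K zc }
    where
      ¬two-x : ¬ TwoKNbrs x
      ¬two-x = two-K-neighbours-impossible (swap₁₂ ρ) (indep₁₂ ind)
      ¬two-y : ¬ TwoKNbrs y
      ¬two-y = two-K-neighbours-impossible ρ ind
      ¬two-z : ¬ TwoKNbrs z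
      ¬two-z = two-K-neighbours-impossible (swap₂₃ ρ) (indep₂₃ ind)

  -- Three outside vertices: any edge among them yields a Hamilton path
  -- (two edges form a path x – y – z, one edge is the case 'edge-outside'),
  -- so they are independent and form the EN_n configuration.
  three-outside : ∀ {r s t} → Outside3 r s t → ENShape
  three-outside {r} {s} {t} ρ with adj? r s | adj? r t | adj? s t
  ... | yes rs | _ | yes st = ⊥-elim (path-outside ρ rs st)
  ... | yes rs | yes rt | no _ = ⊥-elim (path-outside (swap₁₂ ρ) (adj-sym rs) rt)
  ... | no _ | yes rt | yes st = ⊥-elim (path-outside (swap₂₃ ρ) rt (adj-sym st))
  ... | yes rs | no ¬rt | no ¬st = ⊥-elim (edge-outside ρ rs ¬rt ¬st)
  ... | no ¬rs | yes rt | no ¬st = ⊥-elim (edge-outside (swap₂₃ ρ) rt ¬rs (non-adj-sym ¬st))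
  ... | no ¬rs | no ¬rt | yes st =
    ⊥-elim (edge-outside (swap₂₃ (swap₁₂ ρ)) st (non-adj-sym ¬rs) (non-adj-sym ¬rt))
  ... | no ¬rs | no ¬rt | no ¬st = independent-outside ρ (¬rs , ¬rt , ¬st)

  outsiders : List (Fin n)
  outsiders = filter (λ v → ¬? (v ∈? K)) (allFin n)

  outsiders-cover : ∀ v → v ∈ K ⊎ v ∈ outsiders
  outsiders-cover v with v ∈? K
  ... | yes v∈K = inj₁ v∈K
  ... | no v∉K = inj₂ (∈-filter⁺ (λ v → ¬? (v ∈? K)) (∈-allFin v) v∉K)

  outsiders-outside : ∀ {v} → v ∈ outsiders → v ∉ K
  outsiders-outside v∈ = proj₂ (∈-filter⁻ (λ v → ¬? (v ∈? K)) {xs = allFin n} v∈)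

  outsiders-unique : Unique outsiders
  outsiders-unique = filter⁺ (λ v → ¬? (v ∈? K)) (allFin⁺ n)

  few-outsiders : n ∸ 3 ≤ length K → length outsiders ≤ 3
  few-outsiders big = ℕ.+-cancelʳ-≤ (length K) (length outsiders) 3 (begin
    length outsiders + length K  ≡⟨ sym (length-++ outsiders) ⟩
    length (outsiders ++ K)      ≤⟨ unique-length (++⁺ outsiders-unique K-unique
                                      (λ (v∈out , v∈K) → outsiders-outside v∈out v∈K)) ⟩
    n                            ≤⟨ ℕ.m≤n+m∸n n 3 ⟩
    3 + (n ∸ 3)                  ≤⟨ ℕ.+-monoʳ-≤ 3 big ⟩
    3 + length K                 ∎)
    where open ℕ.≤-Reasoning

  shape : ∀ R → Unique R → (∀ {v} → v ∈ R → v ∉ K) → (∀ v → v ∈ K ⊎ v ∈ R) → length R ≤ 3 → ENShape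
  shape [] _ _ cover _ = ⊥-elim (no-outside λ v → [ (λ v∈K → v∈K) , (λ ()) ]′ (cover v))
  shape (r ∷ []) _ out cover _ = ⊥-elim (one-outside (out i0) cover)
  shape (r ∷ s ∷ []) ((r≢s ∷ []) ∷ _) out cover _ = ⊥-elim (two-outside (out i0) (out i1) r≢s cover)
  shape (r ∷ s ∷ t ∷ []) ((r≢s ∷ r≢t ∷ []) ∷ (s≢t ∷ []) ∷ _) out cover _ = three-outside (record
    { x∉K = out i0 ; y∉K = out i1 ; z∉K = out i2 ; x≢y = r≢s ; x≢z = r≢t ; y≢z = s≢t ; cover = cover })
  shape (_ ∷ _ ∷ _ ∷ _ ∷ _) _ _ _ (s≤s (s≤s (s≤s ())))

  en-shape : n ∸ 3 ≤ length K → ENShape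
  en-shape big = shape outsiders outsiders-unique outsiders-outside outsiders-cover (few-outsiders big)

≡ᵇ-true : ∀ {p q} → p ≡ q → (p ≡ᵇ q) ≡ true
≡ᵇ-true {p} {q} = dec-true (p ℕ.≟ q)

≡ᵇ-false : ∀ {p q} → p ≢ q → (p ≡ᵇ q) ≡ false
≡ᵇ-false {p} {q} = dec-false (p ℕ.≟ q)

<ᵇ-true : ∀ {p q} → p < q → (p <ᵇ q) ≡ true
<ᵇ-true {p} {q} = dec-true (p ℕ.<? q)

<ᵇ-false : ∀ {p q} → q ≤ p → (p <ᵇ q) ≡ false
<ᵇ-false {p} {q} q≤p = dec-false (p ℕ.<? q) (ℕ.≤⇒≯ q≤p)

module _ {M : ℕ} where

  en-inside : ∀ {p q} → p < M → q < M → enAdjℕ (3 + M) p q ≡ not (p ≡ᵇ q)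
  en-inside p<M q<M rewrite <ᵇ-true p<M | <ᵇ-true q<M = Bool.∨-identityʳ _

  en-inside-pendant : ∀ {p} i → p < M → enAdjℕ (3 + M) p (i + M) ≡ (p ≡ᵇ i)
  en-inside-pendant i p<M rewrite <ᵇ-true p<M | <ᵇ-false (ℕ.m≤n+m M i) | ℕ.m+n∸n≡m i M = refl

  en-pendant-inside : ∀ {p} i → p < M → enAdjℕ (3 + M) (i + M) p ≡ (p ≡ᵇ i)
  en-pendant-inside i p<M rewrite <ᵇ-true p<M | <ᵇ-false (ℕ.m≤n+m M i) | ℕ.m+n∸n≡m i M =
    Bool.∨-identityʳ _

  en-pendants : ∀ {i j} → i < M → j < M → enAdjℕ (3 + M) (i + M) (j + M) ≡ false
  en-pendants {i} {j} i<M j<M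
    rewrite <ᵇ-false (ℕ.m≤n+m M i) | <ᵇ-false (ℕ.m≤n+m M j) | ℕ.m+n∸n≡m i M | ℕ.m+n∸n≡m j M
          | ≡ᵇ-false (ℕ.<⇒≢ (ℕ.<-≤-trans i<M (ℕ.m≤n+m M j)) ∘ sym)
          | ≡ᵇ-false (ℕ.<⇒≢ (ℕ.<-≤-trans j<M (ℕ.m≤n+m M i)) ∘ sym) = refl

  below-pendants : ∀ {p} → p < 3 + M → (∀ {i} → i < 3 → p ≢ i + M) → p < M
  below-pendants {p} p<3+M not-pendant with p ℕ.<? M
  ... | yes p<M = p<M
  ... | no p≮M = ⊥-elim (not-pendant
          (ℕ.+-cancelʳ-< M (p ∸ M) 3 (subst (_< 3 + M) (sym (ℕ.m∸n+n≡m M≤p)) p<3+M))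
          (sym (ℕ.m∸n+n≡m M≤p)))
    where
      M≤p : M ≤ p
      M≤p = ℕ.≮⇒≥ p≮M

module _ {n : ℕ} where

  permutation-injective : ∀ (π : Permutation′ n) {x y} → π ⟨$⟩ʳ x ≡ π ⟨$⟩ʳ y → x ≡ y
  permutation-injective π {x} {y} πx≡πy =
    trans (sym (inverseˡ π)) (trans (cong (π ⟨$⟩ˡ_) πx≡πy) (inverseˡ π))

  transpose-left : ∀ (i j : Fin n) → PC.transpose i j i ≡ j
  transpose-left i j with i ≟ i
  ... | yes _ = refl
  ... | no i≢i = ⊥-elim (i≢i refl)

  transpose-other : ∀ (i j k : Fin n) → k ≢ i → k ≢ j → PC.transpose i j k ≡ k
  transpose-other i j k k≢i k≢j with k ≟ i
  ... | yes k≡i = ⊥-elim (k≢i k≡i)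
  ... | no _ with k ≟ j
  ...   | yes k≡j = ⊥-elim (k≢j k≡j)
  ...   | no _ = refl

  -- A bijection between two lists of distinct elements of Fin n extends to a
  -- permutation of Fin n: fix the tail by induction, then transpose the image
  -- of the head into place, which moves no already placed element.  (Opaque,
  -- since only the stated property is ever used.)
  opaque
    extend-to-permutation : ∀ xs ys → Unique xs → Unique ys → length xs ≡ length ys →
                            Σ (Permutation′ n) λ π → Pointwise (λ x y → π ⟨$⟩ʳ x ≡ y) xs ys
    extend-to-permutation [] [] _ _ _ = idₚ , []
    extend-to-permutation (x ∷ xs) (y ∷ ys) (x∉ ∷ xs-unique) (y∉ ∷ ys-unique) eq
      with extend-to-permutation xs ys xs-unique ys-unique (ℕ.suc-injective eq)
    ... | σ , σ-places = σ ∘ₚ transpose (σ ⟨$⟩ʳ x) y , transpose-left (σ ⟨$⟩ʳ x) y ∷ keep x∉ y∉ σ-places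
      where
        keep : ∀ {xs ys} → All (x ≢_) xs → All (y ≢_) ys → Pointwise (λ u v → σ ⟨$⟩ʳ u ≡ v) xs ys →
               Pointwise (λ u v → PC.transpose (σ ⟨$⟩ʳ x) y (σ ⟨$⟩ʳ u) ≡ v) xs ys
        keep [] [] [] = []
        keep (x≢x′ ∷ x∉) (y≢y′ ∷ y∉) (σx′≡y′ ∷ places) =
          trans (cong (PC.transpose (σ ⟨$⟩ʳ x) y) σx′≡y′)
            (transpose-other (σ ⟨$⟩ʳ x) y _
              (λ y′≡σx → x≢x′ (permutation-injective σ (sym (trans σx′≡y′ y′≡σx)))) (≢-sym y≢y′)) ∷
          keep x∉ y∉ places

module ENIsomorphism (k : ℕ) (G : Graph (6 + k)) (K : List (Fin (6 + k))) (K-unique : Unique K)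
  (K-clique : ∀ x y → x ∈ K → y ∈ K → x ≢ y → Adj G x y)
  (E : CliquePaths.ENShape G K K-unique K-clique) where

  open GraphFacts G
  open CliquePaths G K K-unique K-clique
  open ENShape E
  open Outside3 outside renaming (x∉K to r∉K; y∉K to s∉K; z∉K to t∉K)

  -- the clique of EN_n occupies the positions below M
  M : ℕ
  M = 3 + k

  3≤M : 3 ≤ M
  3≤M = s≤s (s≤s (s≤s z≤n))

  pendant-position : ∀ i → i < 3 → Fin (3 + M)
  pendant-position i i<3 = fromℕ< (ℕ.+-monoˡ-< M i<3)

  0<3 : 0 < 3
  0<3 = s≤s z≤n
  1<3 : 1 < 3
  1<3 = s≤s (s≤s z≤n)
  2<3 : 2 < 3
  2<3 = s≤s (s≤s (s≤s z≤n))

  sources targets : List (Fin (3 + M))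
  sources = a ∷ b ∷ c ∷ r ∷ s ∷ t ∷ []
  targets = Fin.zero ∷ Fin.suc Fin.zero ∷ Fin.suc (Fin.suc Fin.zero) ∷
            pendant-position 0 0<3 ∷ pendant-position 1 1<3 ∷ pendant-position 2 2<3 ∷ []

  targets-unique : Unique targets
  targets-unique = unique₆ (λ ()) (λ ()) (λ ()) (λ ()) (λ ()) (λ ()) (λ ()) (λ ()) (λ ()) (λ ()) (λ ()) (λ ())
    (apart 0 1 0<3 1<3 (λ ())) (apart 0 2 0<3 2<3 (λ ())) (apart 1 2 1<3 2<3 (λ ()))
    where
      apart : ∀ i j (i<3 : i < 3) (j<3 : j < 3) → i ≢ j → pendant-position i i<3 ≢ pendant-position j j<3
      apart i j _ _ i≢j e = i≢j (ℕ.+-cancelʳ-≡ M i j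
        (trans (sym (FinP.toℕ-fromℕ< _)) (trans (cong toℕ e) (FinP.toℕ-fromℕ< _))))

  placement : Σ (Permutation′ (3 + M)) λ π → Pointwise (λ x y → π ⟨$⟩ʳ x ≡ y) sources targets
  placement = extend-to-permutation sources targets (en-vertices-unique E) targets-unique refl

  -- The permutation is kept opaque: only where it sends the six named
  -- vertices ('placed') is used, and unfolding it would only burden the
  -- type checker.
  opaque
    π : Permutation′ (3 + M)
    π = proj₁ placement

  pos : Fin (3 + M) → ℕ
  pos x = toℕ (π ⟨$⟩ʳ x)

  pos-injective : ∀ {x y} → pos x ≡ pos y → x ≡ y
  pos-injective e = permutation-injective π (FinP.toℕ-injective e)

  record Placed : Set where
    field
      pos-a : pos a ≡ 0
      pos-b : pos b ≡ 1
      pos-c : pos c ≡ 2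
      pos-r : pos r ≡ 0 + M
      pos-s : pos s ≡ 1 + M
      pos-t : pos t ≡ 2 + M

  opaque
    unfolding π

    placed : Placed
    placed = read-off (proj₂ placement)
      where
        pendant : ∀ w i (i<3 : i < 3) → π ⟨$⟩ʳ w ≡ pendant-position i i<3 → pos w ≡ i + M
        pendant w i i<3 πw = trans (cong toℕ πw) (FinP.toℕ-fromℕ< _)
        read-off : Pointwise (λ x y → π ⟨$⟩ʳ x ≡ y) sources targets → Placed
        read-off (πa ∷ πb ∷ πc ∷ πr ∷ πs ∷ πt ∷ []) = record
          { pos-a = cong toℕ πa ; pos-b = cong toℕ πb ; pos-c = cong toℕ πc
          ; pos-r = pendant r 0 0<3 πr ; pos-s = pendant s 1 1<3 πs ; pos-t = pendant t 2 2<3 πt }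

  open Placed placed

  record Pendant (w : Fin (3 + M)) : Set where
    field
      index : ℕ
      index<3 : index < 3
      anchor : Fin (3 + M)
      anchor∈K : anchor ∈ K
      w∉K : w ∉ K
      pos-w : pos w ≡ index + M
      pos-anchor : pos anchor ≡ index
      w~anchor : Adj G w anchor
      anchor-only : ∀ e → e ∈ K → Adj G w e → e ≡ anchor

  classify : ∀ v → v ∈ K ⊎ Pendant v
  classify v with cover v
  ... | inj₁ v∈K = inj₁ v∈K
  ... | inj₂ i0 = inj₂ (record
    { index = 0 ; index<3 = 0<3 ; anchor = a ; anchor∈K = a∈K ; w∉K = r∉K
    ; pos-w = pos-r ; pos-anchor = pos-a ; w~anchor = r~a ; anchor-only = r-only-a })
  ... | inj₂ i1 = inj₂ (record
    { index = 1 ; index<3 = 1<3 ; anchor = b ; anchor∈K = b∈K ; w∉K = s∉K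
    ; pos-w = pos-s ; pos-anchor = pos-b ; w~anchor = s~b ; anchor-only = s-only-b })
  ... | inj₂ i2 = inj₂ (record
    { index = 2 ; index<3 = 2<3 ; anchor = c ; anchor∈K = c∈K ; w∉K = t∉K
    ; pos-w = pos-t ; pos-anchor = pos-c ; w~anchor = t~c ; anchor-only = t-only-c })

  -- clique vertices are placed below M, as the pendant positions are taken
  pos-K : ∀ {x} → x ∈ K → pos x < M
  pos-K {x} x∈K = below-pendants (FinP.toℕ<n (π ⟨$⟩ʳ x)) not-pendant
    where
      differs : ∀ {w} → w ∉ K → pos x ≢ pos w
      differs w∉K e = w∉K (subst (_∈ K) (pos-injective e) x∈K)
      not-pendant : ∀ {i} → i < 3 → pos x ≢ i + M
      not-pendant (s≤s z≤n) e = differs r∉K (trans e (sym pos-r))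
      not-pendant (s≤s (s≤s z≤n)) e = differs s∉K (trans e (sym pos-s))
      not-pendant (s≤s (s≤s (s≤s z≤n))) e = differs t∉K (trans e (sym pos-t))

  adj-inside : ∀ {x y} → x ∈ K → y ∈ K → adj G x y ≡ not (pos x ≡ᵇ pos y)
  adj-inside {x} {y} x∈K y∈K with x ≟ y
  ... | yes refl = trans (irrefl G x) (cong not (sym (≡ᵇ-true {pos x} refl)))
  ... | no x≢y =
    trans (K-clique x y x∈K y∈K x≢y) (cong not (sym (≡ᵇ-false {pos x} {pos y} (x≢y ∘ pos-injective))))

  module _ {w : Fin (3 + M)} (p : Pendant w) where
    open Pendant p

    adj-inside-pendant : ∀ {x} → x ∈ K → adj G x w ≡ (pos x ≡ᵇ index)
    adj-inside-pendant {x} x∈K with x ≟ anchor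
    ... | yes refl = trans (adj-sym w~anchor) (sym (≡ᵇ-true {pos x} {index} pos-anchor))
    ... | no x≢anchor =
      trans (Bool.¬-not (λ xw → x≢anchor (anchor-only x x∈K (adj-sym xw))))
        (sym (≡ᵇ-false {pos x} {index} (λ e → x≢anchor (pos-injective (trans e (sym pos-anchor))))))

    pendant-index<M : index < M
    pendant-index<M = ℕ.<-≤-trans index<3 3≤M

  open Pendant
  open ≡-Reasoning

  preserves : ∀ x y → adj G x y ≡ enAdj (3 + M) (π ⟨$⟩ʳ x) (π ⟨$⟩ʳ y)
  preserves x y with classify x | classify y
  ... | inj₁ x∈K | inj₁ y∈K = trans (adj-inside x∈K y∈K) (sym (en-inside (pos-K x∈K) (pos-K y∈K)))
  ... | inj₁ x∈K | inj₂ q = begin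
    adj G x y                                  ≡⟨ adj-inside-pendant q x∈K ⟩
    (pos x ≡ᵇ index q)                         ≡⟨ sym (en-inside-pendant (index q) (pos-K x∈K)) ⟩
    enAdjℕ (3 + M) (pos x) (index q + M)       ≡⟨ cong (enAdjℕ (3 + M) (pos x)) (sym (pos-w q)) ⟩
    enAdjℕ (3 + M) (pos x) (pos y)             ∎
  ... | inj₂ p | inj₁ y∈K = begin
    adj G x y                                  ≡⟨ Graph.sym G x y ⟩
    adj G y x                                  ≡⟨ adj-inside-pendant p y∈K ⟩
    (pos y ≡ᵇ index p)                         ≡⟨ sym (en-pendant-inside (index p) (pos-K y∈K)) ⟩
    enAdjℕ (3 + M) (index p + M) (pos y)       ≡⟨ cong (λ i → enAdjℕ (3 + M) i (pos y)) (sym (pos-w p)) ⟩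
    enAdjℕ (3 + M) (pos x) (pos y)             ∎
  ... | inj₂ p | inj₂ q = begin
    adj G x y                                  ≡⟨ Bool.¬-not (outside-independent E (w∉K p) (w∉K q)) ⟩
    false                                      ≡⟨ sym (en-pendants (pendant-index<M p) (pendant-index<M q)) ⟩
    enAdjℕ (3 + M) (index p + M) (index q + M) ≡⟨ cong₂ (enAdjℕ (3 + M)) (sym (pos-w p)) (sym (pos-w q)) ⟩
    enAdjℕ (3 + M) (pos x) (pos y)             ∎

  isomorphism : IsoEN G
  isomorphism = ↔⇒⤖ π , preserves

en-isomorphism : ∀ {n} (G : Graph n) (K : List (Fin n)) (K-unique : Unique K)
                 (K-clique : ∀ x y → x ∈ K → y ∈ K → x ≢ y → Adj G x y) →
                 CliquePaths.ENShape G K K-unique K-clique → 6 ≤ n → IsoEN G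
en-isomorphism {suc (suc (suc (suc (suc (suc k)))))} G K K-unique K-clique E
  (s≤s (s≤s (s≤s (s≤s (s≤s (s≤s _)))))) =
  ENIsomorphism.isomorphism k G K K-unique K-clique E

-- The theorem: the clique K witnessing ω(G) ≥ n − 3 has the EN shape,
-- whose six distinct named vertices force n ≥ 6, and that shape is EN_n.
lemma3 : (n : ℕ) (G : Graph n) →
    Connected G → Closed G → ClawFree G → (Traceable G → ⊥) →
    CliqueNumberAtLeast G (n ∸ 3) →
    Σ (6 ≤ n) (λ _ → IsoEN G)
lemma3 n G connected closed claw-free non-traceable (K , (K-unique , K-clique) , |K|≥n∸3) =
  six , en-isomorphism G K K-unique K-clique shape six
  where
    shape : CliquePaths.ENShape G K K-unique K-clique
    shape = NonTraceable.en-shape G connected closed claw-free non-traceable K K-unique K-clique |K|≥n∸3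
    six : 6 ≤ n
    six = unique-length (CliquePaths.en-vertices-unique G K K-unique K-clique shape)
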